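{- Let $\mathcal{E}_n$ be the set of Eulerian tournaments on vertex set $[2n+1]$, and for $v,w\in[2n+1]$ let $\mathcal{E}_n^{v,w}\subseteq\mathcal{E}_n$ be the set of those $D\in\mathcal{E}_n$ with $vw\in E(D)$ and $|N^+(v)\cap N^+(w)|=n-1$. If $n\ge16$, then $|\mathcal{E}_n^{v,w}|\le 2^{14}n^{ -4}|\mathcal{E}_n|$.
   Context: A tournament is a digraph (arcs are ordered pairs of distinct vertices) such that for all distinct $u,v$ exactly one of $uv,vu$ is an arc; it is Eulerian if every vertex has equal in- and out-degree. $N^+(v)=\{u:vu\in E(D)\}$. -}

module Defs where

open import Data.Nat using (ℕ; zero; suc; _+_; _*_)
open import Data.Bool using (Bool; true; false; if_then_else_; _∧_; _∨_; not)
open import Data.Fin using (Fin; zero; suc)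
open import Data.Fin.Properties using (_≟_)
open import Data.List using (List; []; _∷_; map; concatMap; length; filter; allFin; sum)
open import Data.Product using (_×_; _,_)
open import Relation.Nullary using (¬_; Dec; yes; no)
open import Relation.Nullary.Decidable using (⌊_⌋)
open import Relation.Binary.PropositionalEquality using (_≡_)

-- A digraph on vertex set Fin m is given by its arc relation:
-- arc D u v ≡ true  iff  uv ∈ E(D).  Every relation Fin m → Fin m → Bool
-- is a digraph candidate; there are exactly 2^(m*m) of them.
Digraph : ℕ → Set
Digraph m = Fin m → Fin m → Bool

allBoolFuns : (k : ℕ) → List (Fin k → Bool)
allBoolFuns zero = (λ ()) ∷ []
allBoolFuns (suc k) =
  concatMap (λ f → map (λ b → λ { zero → b ; (suc i) → f i }) (true ∷ false ∷ []))
            (allBoolFuns k)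

allRowFuns : (j m : ℕ) → List (Fin j → Fin m → Bool)
allRowFuns zero m = (λ ()) ∷ []
allRowFuns (suc j) m =
  concatMap (λ f → map (λ r → λ { zero → r ; (suc i) → f i }) (allBoolFuns m))
            (allRowFuns j m)

-- all digraphs (arc relations) on Fin m, each exactly once
allDigraphs : (m : ℕ) → List (Digraph m)
allDigraphs m = allRowFuns m m

allV : {m : ℕ} → (Fin m → Bool) → Bool
allV {m} p = Data.List.foldr (λ i b → p i ∧ b) true (allFin m)

countV : {m : ℕ} → (Fin m → Bool) → ℕ
countV {m} p = length (filter (λ i → p i Data.Bool.≟ true) (allFin m))

eqF : {m : ℕ} → Fin m → Fin m → Bool
eqF u v = ⌊ u ≟ v ⌋

isTournament : {m : ℕ} → Digraph m → Bool
isTournament D =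
  allV λ u → allV λ v →
    if eqF u v then not (D u v)
    else ((D u v ∧ not (D v u)) ∨ (not (D u v) ∧ D v u))

outdeg : {m : ℕ} → Digraph m → Fin m → ℕ
outdeg D v = countV (λ u → D v u)

indeg : {m : ℕ} → Digraph m → Fin m → ℕ
indeg D v = countV (λ u → D u v)

isEulerian : {m : ℕ} → Digraph m → Bool
isEulerian D = allV λ v → ⌊ outdeg D v Data.Nat.≟ indeg D v ⌋

isEulerianTournament : {m : ℕ} → Digraph m → Bool
isEulerianTournament D = isTournament D ∧ isEulerian D

commonOut : {m : ℕ} → Digraph m → Fin m → Fin m → ℕ
commonOut D v w = countV (λ u → D v u ∧ D w u)

𝓔 : (n : ℕ) → List (Digraph (suc (2 * n)))
𝓔 n = filter (λ D → isEulerianTournament D Data.Bool.≟ true) (allDigraphs (suc (2 * n)))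

𝓔vw : (n : ℕ) → Fin (suc (2 * n)) → Fin (suc (2 * n)) → List (Digraph (suc (2 * n)))
𝓔vw n v w = filter (λ D → (D v w ∧ ⌊ commonOut D v w Data.Nat.≟ n Data.Nat.∸ 1 ⌋) Data.Bool.≟ true) (𝓔 n)

-- Write e s for the number of Eulerian tournaments D on [2n+1] with vw ∈ D and
-- |N⁺(v) ∩ N⁺(w)| = n − s, so that e 1 = |𝓔ₙ^{v,w}|.  In a regular tournament every vertex w
-- lies on (n² + n)/2 cyclic triangles w → a → c → w, and at most 2sn of them have a ∉ N⁺(v) or
-- c ∉ N⁻(v).  Reversing one of the remaining triangles gives an Eulerian tournament of level
-- s + 1 in which v → a → w → c → v is a 4-cycle, and a tournament of level s + 1 has exactly
-- s(s + 1) such 4-cycles.  Counting the pairs (D, triangle) both ways gives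
--   e s · (n² + n − 4sn) ≤ 2 s(s + 1) · e (s + 1),
-- and the cases s = 1, 2 yield e 1 · n⁴ ≤ 192 · e 3 ≤ 2¹⁴ |𝓔ₙ| once n ≥ 16.

module Submission where

open import Defs
open import Data.Bool using (Bool; true; false; _∧_; _∨_; not; if_then_else_; _xor_)
open import Data.Bool.Properties using (∧-zeroʳ; ∧-identityʳ; ∨-zeroʳ; not-involutive; ¬-not)
open import Data.Fin using (Fin; zero; suc)
import Data.Fin.Properties as Fin
open import Data.List using (List; []; _∷_; map; concatMap; length; filter; tabulate; foldr; _++_)
open import Data.Nat using (ℕ; zero; suc; _+_; _*_; _^_; _∸_; _≤_; z≤n; s≤s; _≟_)
open import Data.Nat.Properties
open import Algebra.Properties.Semiring.Sum +-*-semiring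
  using (sum; sum-cong-≗; ∑-distrib-+; ∑-comm; *-distribˡ-sum; *-distribʳ-sum)
open import Algebra.Properties.CommutativeSemigroup +-commutativeSemigroup
  using () renaming (interchange to +-interchange)
open import Algebra.Properties.CommutativeSemigroup *-commutativeSemigroup
  using () renaming (xy∙z≈xz∙y to *-right-comm)
open import Data.Nat.Tactic.RingSolver using (solve-∀)
open import Data.Product using (_×_; _,_; proj₁; proj₂)
open import Data.Sum using (_⊎_; inj₁; inj₂)
open import Data.Vec.Functional.Relation.Binary.Pointwise using (Pointwise)
open import Data.Vec.Functional using () renaming (_∷_ to _◂_)
open import Function using (_∘_)
open import Relation.Nullary using (¬_; Dec; yes; no; contradiction)
open import Relation.Nullary.Decidable using (⌊_⌋; isYes≗does; dec-true; dec-false)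
open import Relation.Binary.PropositionalEquality

-- Indicators and finite sums

∧-true⁻ : ∀ a {b} → a ∧ b ≡ true → (a ≡ true) × (b ≡ true)
∧-true⁻ true {true} _ = refl , refl

∧-true⁺ : ∀ {a b} → a ≡ true → b ≡ true → a ∧ b ≡ true
∧-true⁺ refl refl = refl

𝟙 : Bool → ℕ
𝟙 true = 1
𝟙 false = 0

𝟙-∧ : ∀ a b → 𝟙 (a ∧ b) ≡ 𝟙 a * 𝟙 b
𝟙-∧ true b = sym (+-identityʳ (𝟙 b))
𝟙-∧ false b = refl

𝟙-not : ∀ a → 𝟙 a + 𝟙 (not a) ≡ 1
𝟙-not true = refl
𝟙-not false = refl

𝟙-idem : ∀ a → 𝟙 a * 𝟙 a ≡ 𝟙 a
𝟙-idem true = refl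
𝟙-idem false = refl

𝟙-xor : ∀ a b → 𝟙 (a xor b) + 2 * (𝟙 a * 𝟙 b) ≡ 𝟙 a + 𝟙 b
𝟙-xor true true = refl
𝟙-xor true false = refl
𝟙-xor false b = +-identityʳ (𝟙 b)

xor-involutive : ∀ a b → a xor (a xor b) ≡ b
xor-involutive true b = not-involutive b
xor-involutive false b = refl

𝟙-xor-pair : ∀ a {x y} → 𝟙 x + 𝟙 y ≡ 1 → 𝟙 (a xor x) + 𝟙 (a xor y) ≡ 1
𝟙-xor-pair false one = one
𝟙-xor-pair true {true} {false} _ = refl
𝟙-xor-pair true {false} {true} _ = refl

𝟙-∧-xor : ∀ r a b → 𝟙 r * 𝟙 (a xor b) + 2 * (𝟙 a * (𝟙 r * 𝟙 b)) ≡ 𝟙 a * 𝟙 r + 𝟙 r * 𝟙 b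
𝟙-∧-xor true true true = refl
𝟙-∧-xor true true false = refl
𝟙-∧-xor true false true = refl
𝟙-∧-xor true false false = refl
𝟙-∧-xor false true b = refl
𝟙-∧-xor false false b = refl

𝟙-mono : ∀ {a b} → (a ≡ true → b ≡ true) → 𝟙 a ≤ 𝟙 b
𝟙-mono {false} _ = z≤n
𝟙-mono {true} a⇒b rewrite a⇒b refl = s≤s z≤n

sum-mono-≤ : ∀ {m} {f g : Fin m → ℕ} → (∀ i → f i ≤ g i) → sum f ≤ sum g
sum-mono-≤ {zero} f≤g = z≤n
sum-mono-≤ {suc m} f≤g = +-mono-≤ (f≤g zero) (sum-mono-≤ (f≤g ∘ suc))

sum-zero : ∀ m → sum {m} (λ _ → 0) ≡ 0
sum-zero zero = refl
sum-zero (suc m) = sum-zero m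

sum-one : ∀ m → sum {m} (λ _ → 1) ≡ m
sum-one zero = refl
sum-one (suc m) = cong suc (sum-one m)

⌊⌋-true : ∀ {P : Set} (p? : Dec P) → P → ⌊ p? ⌋ ≡ true
⌊⌋-true p? p = trans (isYes≗does p?) (dec-true p? p)

⌊⌋-false : ∀ {P : Set} (p? : Dec P) → ¬ P → ⌊ p? ⌋ ≡ false
⌊⌋-false p? ¬p = trans (isYes≗does p?) (dec-false p? ¬p)

⌊⌋-sound : ∀ {P : Set} (p? : Dec P) → ⌊ p? ⌋ ≡ true → P
⌊⌋-sound (yes p) _ = p

⌊⌋-complete : ∀ {P : Set} (p? : Dec P) → ⌊ p? ⌋ ≡ false → ¬ P
⌊⌋-complete (no ¬p) _ = ¬p

⌊⌋-cong : ∀ {P Q : Set} (p? : Dec P) (q? : Dec Q) → (P → Q) → (Q → P) → ⌊ p? ⌋ ≡ ⌊ q? ⌋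
⌊⌋-cong p? q? P→Q Q→P with p? | q?
... | yes _ | yes _ = refl
... | no _ | no _ = refl
... | yes p | no ¬q = contradiction (P→Q p) ¬q
... | no ¬p | yes q = contradiction (Q→P q) ¬p

eqF-refl : ∀ {m} (i : Fin m) → eqF i i ≡ true
eqF-refl i = ⌊⌋-true (i Fin.≟ i) refl

eqF-≢ : ∀ {m} {i j : Fin m} → i ≢ j → eqF i j ≡ false
eqF-≢ {i = i} {j} = ⌊⌋-false (i Fin.≟ j)

eqF-sym : ∀ {m} (i j : Fin m) → eqF i j ≡ eqF j i
eqF-sym i j with i Fin.≟ j
... | yes refl = sym (eqF-refl i)
... | no i≢j = sym (eqF-≢ (i≢j ∘ sym))

eqF-suc : ∀ {m} (i j : Fin m) → eqF (suc i) (suc j) ≡ eqF i j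
eqF-suc i j with i Fin.≟ j
... | yes _ = refl
... | no _ = refl

sum-δ : ∀ {m} (u : Fin m) (f : Fin m → ℕ) → sum (λ k → 𝟙 (eqF k u) * f k) ≡ f u
sum-δ {suc m} zero f = begin
  f zero + 0 + sum (λ k → 0 * f (suc k)) ≡⟨ cong₂ _+_ (+-identityʳ (f zero)) (sum-zero m) ⟩
  f zero + 0                             ≡⟨ +-identityʳ (f zero) ⟩
  f zero                                 ∎
  where open ≡-Reasoning
sum-δ {suc m} (suc u) f = begin
  sum (λ k → 𝟙 (eqF k (suc u)) * f k)        ≡⟨ sum-cong-≗ (λ k → cong (λ b → 𝟙 b * f (suc k)) (eqF-suc k u)) ⟩
  sum (λ k → 𝟙 (eqF k u) * f (suc k))         ≡⟨ sum-δ u (f ∘ suc) ⟩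
  f (suc u)                                  ∎
  where open ≡-Reasoning

sum-+2* : ∀ {m} {f g h l : Fin m → ℕ} → (∀ k → f k + 2 * g k ≡ h k + l k) →
  sum f + 2 * sum g ≡ sum h + sum l
sum-+2* {f = f} {g} {h} {l} eq = begin
  sum f + 2 * sum g                 ≡⟨ cong (sum f +_) (*-distribˡ-sum 2 g) ⟩
  sum f + sum (λ k → 2 * g k)       ≡⟨ ∑-distrib-+ f (λ k → 2 * g k) ⟨
  sum (λ k → f k + 2 * g k)         ≡⟨ sum-cong-≗ eq ⟩
  sum (λ k → h k + l k)             ≡⟨ ∑-distrib-+ h l ⟩
  sum h + sum l                     ∎
  where open ≡-Reasoning

sum-𝟙-xor : ∀ {m} (μ x : Fin m → Bool) →
  sum (λ k → 𝟙 (μ k xor x k)) + 2 * sum (λ k → 𝟙 (μ k) * 𝟙 (x k)) ≡ sum (𝟙 ∘ μ) + sum (𝟙 ∘ x)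
sum-𝟙-xor μ x = sum-+2* (λ k → 𝟙-xor (μ k) (x k))

sum-𝟙-∧-xor : ∀ {m} (r μ x : Fin m → Bool) →
  sum (λ k → 𝟙 (r k) * 𝟙 (μ k xor x k)) + 2 * sum (λ k → 𝟙 (μ k) * (𝟙 (r k) * 𝟙 (x k)))
    ≡ sum (λ k → 𝟙 (μ k) * 𝟙 (r k)) + sum (λ k → 𝟙 (r k) * 𝟙 (x k))
sum-𝟙-∧-xor r μ x = sum-+2* (λ k → 𝟙-∧-xor (r k) (μ k) (x k))

countV-tabulate : ∀ {m M} (p : Fin M → Bool) (g : Fin m → Fin M) →
  length (filter (λ i → p i Data.Bool.≟ true) (tabulate g)) ≡ sum (𝟙 ∘ p ∘ g)
countV-tabulate {zero} p g = refl
countV-tabulate {suc m} p g with p (g zero)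
... | true = cong suc (countV-tabulate p (g ∘ suc))
... | false = countV-tabulate p (g ∘ suc)

countV≡sum : ∀ {m} (p : Fin m → Bool) → countV p ≡ sum (𝟙 ∘ p)
countV≡sum p = countV-tabulate p (λ i → i)

allV-tabulate⁻ : ∀ {m M} (p : Fin M → Bool) (g : Fin m → Fin M) →
  foldr (λ i b → p i ∧ b) true (tabulate g) ≡ true → ∀ i → p (g i) ≡ true
allV-tabulate⁻ {suc m} p g all with p (g zero) in eq
allV-tabulate⁻ {suc m} p g all | true = λ { zero → eq ; (suc i) → allV-tabulate⁻ p (g ∘ suc) all i }

allV-tabulate⁺ : ∀ {m M} (p : Fin M → Bool) (g : Fin m → Fin M) →
  (∀ i → p (g i) ≡ true) → foldr (λ i b → p i ∧ b) true (tabulate g) ≡ true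
allV-tabulate⁺ {zero} p g all = refl
allV-tabulate⁺ {suc m} p g all rewrite all zero = allV-tabulate⁺ p (g ∘ suc) (all ∘ suc)

allV-tabulate-cong : ∀ {m M} {p q : Fin M → Bool} (g : Fin m → Fin M) → p ≗ q →
  foldr (λ i b → p i ∧ b) true (tabulate g) ≡ foldr (λ i b → q i ∧ b) true (tabulate g)
allV-tabulate-cong {zero} g p≗q = refl
allV-tabulate-cong {suc m} g p≗q = cong₂ _∧_ (p≗q (g zero)) (allV-tabulate-cong (g ∘ suc) p≗q)

allV⁻ : ∀ {m} {p : Fin m → Bool} → allV p ≡ true → ∀ i → p i ≡ true
allV⁻ {p = p} = allV-tabulate⁻ p (λ i → i)

allV⁺ : ∀ {m} {p : Fin m → Bool} → (∀ i → p i ≡ true) → allV p ≡ true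
allV⁺ {p = p} = allV-tabulate⁺ p (λ i → i)

allV-cong : ∀ {m} {p q : Fin m → Bool} → p ≗ q → allV p ≡ allV q
allV-cong = allV-tabulate-cong (λ i → i)

countV-cong : ∀ {m} {p q : Fin m → Bool} → p ≗ q → countV p ≡ countV q
countV-cong {p = p} {q} p≗q = begin
  countV p      ≡⟨ countV≡sum p ⟩
  sum (𝟙 ∘ p)   ≡⟨ sum-cong-≗ (cong 𝟙 ∘ p≗q) ⟩
  sum (𝟙 ∘ q)   ≡⟨ countV≡sum q ⟨
  countV q      ∎
  where open ≡-Reasoning

∑ᴸ : {A : Set} → (A → ℕ) → List A → ℕ
∑ᴸ g [] = 0
∑ᴸ g (x ∷ xs) = g x + ∑ᴸ g xs

module _ {A : Set} where

  ∑ᴸ-cong : ∀ {f g : A → ℕ} → f ≗ g → ∀ xs → ∑ᴸ f xs ≡ ∑ᴸ g xs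
  ∑ᴸ-cong f≗g [] = refl
  ∑ᴸ-cong f≗g (x ∷ xs) = cong₂ _+_ (f≗g x) (∑ᴸ-cong f≗g xs)

  ∑ᴸ-mono-≤ : ∀ {f g : A → ℕ} → (∀ x → f x ≤ g x) → ∀ xs → ∑ᴸ f xs ≤ ∑ᴸ g xs
  ∑ᴸ-mono-≤ f≤g [] = z≤n
  ∑ᴸ-mono-≤ f≤g (x ∷ xs) = +-mono-≤ (f≤g x) (∑ᴸ-mono-≤ f≤g xs)

  ∑ᴸ-++ : ∀ (g : A → ℕ) xs ys → ∑ᴸ g (xs ++ ys) ≡ ∑ᴸ g xs + ∑ᴸ g ys
  ∑ᴸ-++ g [] ys = refl
  ∑ᴸ-++ g (x ∷ xs) ys = trans (cong (g x +_) (∑ᴸ-++ g xs ys)) (sym (+-assoc (g x) _ _))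

  ∑ᴸ-distrib-+ : ∀ (f g : A → ℕ) xs → ∑ᴸ (λ x → f x + g x) xs ≡ ∑ᴸ f xs + ∑ᴸ g xs
  ∑ᴸ-distrib-+ f g [] = refl
  ∑ᴸ-distrib-+ f g (x ∷ xs) =
    trans (cong (f x + g x +_) (∑ᴸ-distrib-+ f g xs)) (+-interchange (f x) (g x) _ _)

  *-distribʳ-∑ᴸ : ∀ (f : A → ℕ) c xs → ∑ᴸ (λ x → f x * c) xs ≡ ∑ᴸ f xs * c
  *-distribʳ-∑ᴸ f c [] = refl
  *-distribʳ-∑ᴸ f c (x ∷ xs) =
    trans (cong (f x * c +_) (*-distribʳ-∑ᴸ f c xs)) (sym (*-distribʳ-+ c (f x) _))

  *-distribˡ-∑ᴸ : ∀ c (f : A → ℕ) xs → ∑ᴸ (λ x → c * f x) xs ≡ c * ∑ᴸ f xs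
  *-distribˡ-∑ᴸ c f [] = sym (*-zeroʳ c)
  *-distribˡ-∑ᴸ c f (x ∷ xs) =
    trans (cong (c * f x +_) (*-distribˡ-∑ᴸ c f xs)) (sym (*-distribˡ-+ c (f x) _))

  ∑ᴸ-sum-comm : ∀ {m} (f : A → Fin m → ℕ) xs →
    ∑ᴸ (λ x → sum (f x)) xs ≡ sum (λ i → ∑ᴸ (λ x → f x i) xs)
  ∑ᴸ-sum-comm {m} f [] = sym (sum-zero m)
  ∑ᴸ-sum-comm f (x ∷ xs) =
    trans (cong (sum (f x) +_) (∑ᴸ-sum-comm f xs)) (sym (∑-distrib-+ (f x) _))

  ∑ᴸ-sum²-comm : ∀ {m} (f : A → Fin m → Fin m → ℕ) xs →
    ∑ᴸ (λ x → sum (λ a → sum (f x a))) xs ≡ sum (λ a → sum (λ c → ∑ᴸ (λ x → f x a c) xs))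
  ∑ᴸ-sum²-comm f xs =
    trans (∑ᴸ-sum-comm (λ x a → sum (f x a)) xs) (sum-cong-≗ (λ a → ∑ᴸ-sum-comm (λ x → f x a) xs))

  ∑ᴸ-filter : ∀ (p : A → Bool) (g : A → ℕ) xs →
    ∑ᴸ g (filter (λ x → p x Data.Bool.≟ true) xs) ≡ ∑ᴸ (λ x → 𝟙 (p x) * g x) xs
  ∑ᴸ-filter p g [] = refl
  ∑ᴸ-filter p g (x ∷ xs) with p x
  ... | true = cong₂ _+_ (sym (+-identityʳ (g x))) (∑ᴸ-filter p g xs)
  ... | false = ∑ᴸ-filter p g xs

  length-filter : ∀ (p : A → Bool) xs →
    length (filter (λ x → p x Data.Bool.≟ true) xs) ≡ ∑ᴸ (𝟙 ∘ p) xs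
  length-filter p [] = refl
  length-filter p (x ∷ xs) with p x
  ... | true = cong suc (length-filter p xs)
  ... | false = length-filter p xs

module _ {A B : Set} where

  ∑ᴸ-map : ∀ (g : B → ℕ) (h : A → B) xs → ∑ᴸ g (map h xs) ≡ ∑ᴸ (g ∘ h) xs
  ∑ᴸ-map g h [] = refl
  ∑ᴸ-map g h (x ∷ xs) = cong (g (h x) +_) (∑ᴸ-map g h xs)

  ∑ᴸ-concatMap : ∀ (g : B → ℕ) (F : A → List B) xs →
    ∑ᴸ g (concatMap F xs) ≡ ∑ᴸ (∑ᴸ g ∘ F) xs
  ∑ᴸ-concatMap g F [] = refl
  ∑ᴸ-concatMap g F (x ∷ xs) =
    trans (∑ᴸ-++ g (F x) _) (cong (∑ᴸ g (F x) +_) (∑ᴸ-concatMap g F xs))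

Respects : {B : Set} → (B → B → Set) → (B → ℕ) → Set
Respects _≈_ g = ∀ {x y} → x ≈ y → g x ≡ g y

SumInvariant : {B : Set} → (B → B → Set) → List B → (B → B) → Set
SumInvariant _≈_ xs τ = ∀ g → Respects _≈_ g → ∑ᴸ g xs ≡ ∑ᴸ (g ∘ τ) xs

-- Stated through sums because Defs builds the extended functions as pattern-matching lambdas,
-- which are only pointwise equal to x ◂ f.
ExtendsBy : {A : Set} {k : ℕ} → (A → A → Set) → List A → List (Fin k → A) → List (Fin (suc k) → A) → Set
ExtendsBy _≈_ xs fs gs =
  ∀ g → Respects (Pointwise _≈_) g → ∑ᴸ g gs ≡ ∑ᴸ (λ f → ∑ᴸ (λ x → g (x ◂ f)) xs) fs

module _ {A : Set} {_≈_ : A → A → Set} (≈-refl : ∀ {x} → x ≈ x) (xs : List A)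
         (Fs : ∀ k → List (Fin k → A)) (extends : ∀ k → ExtendsBy _≈_ xs (Fs k) (Fs (suc k))) where

  ∑ᴸ-pointwise-invariant : ∀ k (τ : Fin k → A → A) →
    (∀ i {x y} → x ≈ y → τ i x ≈ τ i y) → (∀ i → SumInvariant _≈_ xs (τ i)) →
    SumInvariant (Pointwise _≈_) (Fs k) (λ f i → τ i (f i))
  ∑ᴸ-pointwise-invariant zero τ τ-resp τ-inv g g-resp = ∑ᴸ-cong (λ f → g-resp (λ ())) (Fs zero)
  ∑ᴸ-pointwise-invariant (suc k) τ τ-resp τ-inv g g-resp = begin
    ∑ᴸ g (Fs (suc k))                 ≡⟨ extends k g g-resp ⟩
    ∑ᴸ (G g) (Fs k)                   ≡⟨ ∑ᴸ-pointwise-invariant k (τ ∘ suc) (τ-resp ∘ suc) (τ-inv ∘ suc)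
                                           (G g) (G-resp g-resp) ⟩
    ∑ᴸ (G g ∘ τ′) (Fs k)              ≡⟨ ∑ᴸ-cong step (Fs k) ⟩
    ∑ᴸ (G (g ∘ τ*)) (Fs k)            ≡⟨ extends k (g ∘ τ*) (g-resp ∘ τ*-resp) ⟨
    ∑ᴸ (g ∘ τ*) (Fs (suc k))          ∎
    where
    open ≡-Reasoning
    τ* : (Fin (suc k) → A) → Fin (suc k) → A
    τ* f i = τ i (f i)
    τ′ : (Fin k → A) → Fin k → A
    τ′ f i = τ (suc i) (f i)
    G : ((Fin (suc k) → A) → ℕ) → (Fin k → A) → ℕ
    G h f = ∑ᴸ (λ x → h (x ◂ f)) xs
    ◂-resp : ∀ {x y f h} → x ≈ y → Pointwise _≈_ f h → Pointwise _≈_ (x ◂ f) (y ◂ h)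
    ◂-resp x≈y f≈h zero = x≈y
    ◂-resp x≈y f≈h (suc i) = f≈h i
    τ*-resp : ∀ {f h} → Pointwise _≈_ f h → Pointwise _≈_ (τ* f) (τ* h)
    τ*-resp f≈h i = τ-resp i (f≈h i)
    G-resp : ∀ {h} → Respects (Pointwise _≈_) h → Respects (Pointwise _≈_) (G h)
    G-resp h-resp f≈f′ = ∑ᴸ-cong (λ x → h-resp (◂-resp ≈-refl f≈f′)) xs
    step : ∀ f → G g (τ′ f) ≡ G (g ∘ τ*) f
    step f = trans (τ-inv zero _ (λ x≈y → g-resp (◂-resp x≈y (λ _ → ≈-refl))))
                   (∑ᴸ-cong (λ x → g-resp λ { zero → ≈-refl ; (suc i) → ≈-refl }) xs)

xor-sum-invariant : ∀ b → SumInvariant _≡_ (true ∷ false ∷ []) (b xor_)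
xor-sum-invariant false g _ = refl
xor-sum-invariant true g _ = begin
  g true + (g false + 0)  ≡⟨ cong (g true +_) (+-identityʳ (g false)) ⟩
  g true + g false        ≡⟨ +-comm (g true) (g false) ⟩
  g false + g true        ≡⟨ cong (g false +_) (+-identityʳ (g true)) ⟨
  g false + (g true + 0)  ∎
  where open ≡-Reasoning

allBoolFuns-extends : ∀ k → ExtendsBy _≡_ (true ∷ false ∷ []) (allBoolFuns k) (allBoolFuns (suc k))
allBoolFuns-extends k g g-resp =
  trans (∑ᴸ-concatMap g _ (allBoolFuns k))
        (∑ᴸ-cong (λ f → cong₂ _+_ (g-resp λ { zero → refl ; (suc i) → refl })
                                  (cong (_+ 0) (g-resp λ { zero → refl ; (suc i) → refl })))
                 (allBoolFuns k))

allRowFuns-extends : ∀ m k →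
  ExtendsBy (Pointwise _≡_) (allBoolFuns m) (allRowFuns k m) (allRowFuns (suc k) m)
allRowFuns-extends m k g g-resp =
  trans (∑ᴸ-concatMap g _ (allRowFuns k m))
        (∑ᴸ-cong (λ f → trans (∑ᴸ-map g _ (allBoolFuns m))
                              (∑ᴸ-cong (λ r → g-resp λ { zero _ → refl ; (suc i) _ → refl }) (allBoolFuns m)))
                 (allRowFuns k m))

allBoolFuns-xor-invariant : ∀ k (μ : Fin k → Bool) →
  SumInvariant (Pointwise _≡_) (allBoolFuns k) (λ f i → μ i xor f i)
allBoolFuns-xor-invariant k μ =
  ∑ᴸ-pointwise-invariant refl (true ∷ false ∷ []) allBoolFuns allBoolFuns-extends k
    (λ i → μ i xor_) (λ i → cong (μ i xor_)) (xor-sum-invariant ∘ μ)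

allDigraphs-xor-invariant : ∀ m (M : Digraph m) →
  SumInvariant (Pointwise (Pointwise _≡_)) (allDigraphs m) (λ D i j → M i j xor D i j)
allDigraphs-xor-invariant m M =
  ∑ᴸ-pointwise-invariant (λ _ → refl) (allBoolFuns m) (λ k → allRowFuns k m) (allRowFuns-extends m) m
    (λ i f j → M i j xor f j) (λ i f≈g j → cong (M i j xor_) (f≈g j)) (allBoolFuns-xor-invariant m ∘ M)

-- Tournaments

d⁺ d⁻ : ∀ {m} → Digraph m → Fin m → ℕ
d⁺ D u = sum (λ k → 𝟙 (D u k))
d⁻ D u = sum (λ k → 𝟙 (D k u))

tournament-clause⁻ : ∀ e a b → (if e then not a else ((a ∧ not b) ∨ (not a ∧ b))) ≡ true →
  (e ≡ true → a ≡ false) × (e ≡ false → 𝟙 a + 𝟙 b ≡ 1)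
tournament-clause⁻ true false b _ = (λ _ → refl) , λ ()
tournament-clause⁻ false true false _ = (λ ()) , λ _ → refl
tournament-clause⁻ false false true _ = (λ ()) , λ _ → refl

tournament-clause⁺ : ∀ e a b → (e ≡ true → a ≡ false) → (e ≡ false → 𝟙 a + 𝟙 b ≡ 1) →
  (if e then not a else ((a ∧ not b) ∨ (not a ∧ b))) ≡ true
tournament-clause⁺ true a b loopless _ rewrite loopless refl = refl
tournament-clause⁺ false true false _ _ = refl
tournament-clause⁺ false false true _ _ = refl
tournament-clause⁺ false true true _ one with () ← one refl
tournament-clause⁺ false false false _ one with () ← one refl

isTournament⁺ : ∀ {m} (D : Digraph m) → (∀ u → D u u ≡ false) →
  (∀ u v → u ≢ v → 𝟙 (D u v) + 𝟙 (D v u) ≡ 1) → isTournament D ≡ true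
isTournament⁺ D loopless one = allV⁺ λ u → allV⁺ λ v →
  tournament-clause⁺ (eqF u v) (D u v) (D v u)
    (λ u=v → subst (λ z → D u z ≡ false) (⌊⌋-sound (u Fin.≟ v) u=v) (loopless u))
    (λ u≠v → one u v (⌊⌋-complete (u Fin.≟ v) u≠v))

isEulerian⁺ : ∀ {m} (D : Digraph m) → (∀ u → d⁺ D u ≡ d⁻ D u) → isEulerian D ≡ true
isEulerian⁺ D balanced = allV⁺ λ u →
  ⌊⌋-true (outdeg D u ≟ indeg D u)
    (trans (countV≡sum (D u)) (trans (balanced u) (sym (countV≡sum (λ k → D k u)))))

module Tournament {m} (D : Digraph m) (isT : isTournament D ≡ true) where

  private
    clause : ∀ u v → _
    clause u v = tournament-clause⁻ (eqF u v) (D u v) (D v u) (allV⁻ (allV⁻ isT u) v)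

  loopless : ∀ u → D u u ≡ false
  loopless u = proj₁ (clause u u) (eqF-refl u)

  𝟙-trichotomy : ∀ u k → 𝟙 (D u k) + 𝟙 (D k u) + 𝟙 (eqF k u) ≡ 1
  𝟙-trichotomy u k with k Fin.≟ u
  ... | yes refl rewrite loopless k = refl
  ... | no k≢u = trans (+-identityʳ _) (proj₂ (clause u k) (eqF-≢ (k≢u ∘ sym)))

  exactly-one : ∀ {u k} → u ≢ k → 𝟙 (D u k) + 𝟙 (D k u) ≡ 1
  exactly-one {u} {k} u≢k = begin
    𝟙 (D u k) + 𝟙 (D k u)                  ≡⟨ +-identityʳ _ ⟨
    𝟙 (D u k) + 𝟙 (D k u) + 𝟙 false        ≡⟨ cong (λ x → 𝟙 (D u k) + 𝟙 (D k u) + 𝟙 x) (eqF-≢ (u≢k ∘ sym)) ⟨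
    𝟙 (D u k) + 𝟙 (D k u) + 𝟙 (eqF k u)    ≡⟨ 𝟙-trichotomy u k ⟩
    1                                      ∎
    where open ≡-Reasoning

  asym : ∀ {u k} → D u k ≡ true → D k u ≡ false
  asym {u} {k} uk with D k u in ku | 𝟙-trichotomy u k
  ... | false | _ = refl
  ... | true | one rewrite uk with () ← one

  arc⇒≢ : ∀ {u k} → D u k ≡ true → u ≢ k
  arc⇒≢ {u} uk refl with () ← trans (sym uk) (loopless u)

  sum-split : ∀ (f : Fin m → ℕ) u →
    sum (λ c → f c * 𝟙 (D u c)) + sum (λ c → f c * 𝟙 (D c u)) + f u ≡ sum f
  sum-split f u = begin
    sum (λ c → f c * 𝟙 (D u c)) + sum (λ c → f c * 𝟙 (D c u)) + f u
      ≡⟨ cong (sum (λ c → f c * 𝟙 (D u c)) + sum (λ c → f c * 𝟙 (D c u)) +_)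
              (trans (sum-cong-≗ (λ c → *-comm (f c) (𝟙 (eqF c u)))) (sum-δ u f)) ⟨
    sum (λ c → f c * 𝟙 (D u c)) + sum (λ c → f c * 𝟙 (D c u)) + sum (λ c → f c * 𝟙 (eqF c u))
      ≡⟨ cong (_+ _) (∑-distrib-+ (λ c → f c * 𝟙 (D u c)) _) ⟨
    sum (λ c → f c * 𝟙 (D u c) + f c * 𝟙 (D c u)) + sum (λ c → f c * 𝟙 (eqF c u))
      ≡⟨ ∑-distrib-+ (λ c → f c * 𝟙 (D u c) + f c * 𝟙 (D c u)) _ ⟨
    sum (λ c → f c * 𝟙 (D u c) + f c * 𝟙 (D c u) + f c * 𝟙 (eqF c u))
      ≡⟨ sum-cong-≗ (λ c → factor (f c) (𝟙-trichotomy u c)) ⟩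
    sum f
      ∎
    where
    open ≡-Reasoning
    factor : ∀ x {a b e} → a + b + e ≡ 1 → x * a + x * b + x * e ≡ x
    factor x {a} {b} {e} one = begin
      x * a + x * b + x * e  ≡⟨ cong (_+ x * e) (*-distribˡ-+ x a b) ⟨
      x * (a + b) + x * e    ≡⟨ *-distribˡ-+ x (a + b) e ⟨
      x * (a + b + e)        ≡⟨ cong (x *_) one ⟩
      x * 1                  ≡⟨ *-identityʳ x ⟩
      x                      ∎

  d⁺+d⁻ : ∀ u → d⁺ D u + d⁻ D u + 1 ≡ m
  d⁺+d⁻ u = begin
    d⁺ D u + d⁻ D u + 1
      ≡⟨ cong₂ (λ p q → p + q + 1) (sum-cong-≗ (λ c → *-identityˡ (𝟙 (D u c))))
                                   (sum-cong-≗ (λ c → *-identityˡ (𝟙 (D c u)))) ⟨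
    sum (λ c → 1 * 𝟙 (D u c)) + sum (λ c → 1 * 𝟙 (D c u)) + 1
      ≡⟨ sum-split (λ _ → 1) u ⟩
    sum {m} (λ _ → 1)
      ≡⟨ sum-one m ⟩
    m ∎
    where open ≡-Reasoning

  𝟙-asym : ∀ u k → 𝟙 (D u k) * 𝟙 (D k u) ≡ 0
  𝟙-asym u k with D u k in uk
  ... | true rewrite asym uk = refl
  ... | false = refl

  sum-arcs-within : ∀ (p : Fin m → ℕ) →
    2 * sum (λ a → sum (λ c → p a * p c * 𝟙 (D a c))) + sum (λ a → p a * p a) ≡ sum p * sum p
  sum-arcs-within p = begin
    2 * S + sum (λ a → p a * p a)
      ≡⟨ cong (λ x → S + x + sum (λ a → p a * p a)) (trans (+-identityʳ S) S≡S′) ⟩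
    S + S′ + sum (λ a → p a * p a)
      ≡⟨ cong (_+ sum (λ a → p a * p a)) (∑-distrib-+ (λ a → sum (λ c → p a * p c * 𝟙 (D a c))) _) ⟨
    sum (λ a → sum (λ c → p a * p c * 𝟙 (D a c)) + sum (λ c → p a * p c * 𝟙 (D c a)))
      + sum (λ a → p a * p a)
      ≡⟨ ∑-distrib-+ (λ a → sum (λ c → p a * p c * 𝟙 (D a c)) + sum (λ c → p a * p c * 𝟙 (D c a))) _ ⟨
    sum (λ a → sum (λ c → p a * p c * 𝟙 (D a c)) + sum (λ c → p a * p c * 𝟙 (D c a)) + p a * p a)
      ≡⟨ sum-cong-≗ (λ a → trans (sum-split (λ c → p a * p c) a) (sym (*-distribˡ-sum (p a) p))) ⟩
    sum (λ a → p a * sum p)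
      ≡⟨ *-distribʳ-sum (sum p) p ⟨
    sum p * sum p
      ∎
    where
    open ≡-Reasoning
    S S′ : ℕ
    S = sum (λ a → sum (λ c → p a * p c * 𝟙 (D a c)))
    S′ = sum (λ a → sum (λ c → p a * p c * 𝟙 (D c a)))
    S≡S′ : S ≡ S′
    S≡S′ = trans (sum-cong-≗ (λ a → sum-cong-≗ (λ c → cong (_* 𝟙 (D a c)) (*-comm (p a) (p c)))))
                 (∑-comm (λ a c → p c * p a * 𝟙 (D a c)))

module EulerianTournament (n : ℕ) (D : Digraph (suc (2 * n)))
                          (isET : isEulerianTournament D ≡ true) where

  isT : isTournament D ≡ true
  isT = proj₁ (∧-true⁻ (isTournament D) isET)

  open Tournament D isT public

  d⁺≡d⁻ : ∀ u → d⁺ D u ≡ d⁻ D u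
  d⁺≡d⁻ u = begin
    d⁺ D u        ≡⟨ countV≡sum (D u) ⟨
    outdeg D u    ≡⟨ ⌊⌋-sound (outdeg D u ≟ indeg D u) (allV⁻ (proj₂ (∧-true⁻ (isTournament D) isET)) u) ⟩
    indeg D u     ≡⟨ countV≡sum (λ k → D k u) ⟩
    d⁻ D u        ∎
    where open ≡-Reasoning

  d⁺≡n : ∀ u → d⁺ D u ≡ n
  d⁺≡n u = *-cancelˡ-≡ (d⁺ D u) n 2 (+-cancelʳ-≡ 1 _ _ (begin
    2 * d⁺ D u + 1             ≡⟨ cong (λ x → d⁺ D u + x + 1) (+-identityʳ (d⁺ D u)) ⟩
    d⁺ D u + d⁺ D u + 1        ≡⟨ cong (λ x → d⁺ D u + x + 1) (d⁺≡d⁻ u) ⟩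
    d⁺ D u + d⁻ D u + 1        ≡⟨ d⁺+d⁻ u ⟩
    suc (2 * n)                ≡⟨ +-comm 1 (2 * n) ⟩
    2 * n + 1                  ∎))
    where open ≡-Reasoning

  d⁻≡n : ∀ u → d⁻ D u ≡ n
  d⁻≡n u = trans (sym (d⁺≡d⁻ u)) (d⁺≡n u)

  cyclicThrough transitiveFrom : Fin (suc (2 * n)) → ℕ
  cyclicThrough w = sum (λ a → sum (λ c → 𝟙 (D w a) * 𝟙 (D a c) * 𝟙 (D c w)))
  transitiveFrom w = sum (λ a → sum (λ c → 𝟙 (D w a) * 𝟙 (D a c) * 𝟙 (D w c)))

  transitive+cyclic : ∀ w → transitiveFrom w + cyclicThrough w ≡ n * n
  transitive+cyclic w = begin
    transitiveFrom w + cyclicThrough w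
      ≡⟨ ∑-distrib-+ (λ a → sum (λ c → f a c * 𝟙 (D w c))) (λ a → sum (λ c → f a c * 𝟙 (D c w))) ⟨
    sum (λ a → sum (λ c → f a c * 𝟙 (D w c)) + sum (λ c → f a c * 𝟙 (D c w)))
      ≡⟨ sum-cong-≗ per-vertex ⟩
    sum (λ a → 𝟙 (D w a) * n)
      ≡⟨ *-distribʳ-sum n (𝟙 ∘ D w) ⟨
    d⁺ D w * n
      ≡⟨ cong (_* n) (d⁺≡n w) ⟩
    n * n
      ∎
    where
    open ≡-Reasoning
    f : Fin (suc (2 * n)) → Fin (suc (2 * n)) → ℕ
    f a c = 𝟙 (D w a) * 𝟙 (D a c)
    per-vertex : ∀ a → sum (λ c → f a c * 𝟙 (D w c)) + sum (λ c → f a c * 𝟙 (D c w)) ≡ 𝟙 (D w a) * n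
    per-vertex a = begin
      sum (λ c → f a c * 𝟙 (D w c)) + sum (λ c → f a c * 𝟙 (D c w))
        ≡⟨ +-identityʳ _ ⟨
      sum (λ c → f a c * 𝟙 (D w c)) + sum (λ c → f a c * 𝟙 (D c w)) + 0
        ≡⟨ cong (sum (λ c → f a c * 𝟙 (D w c)) + sum (λ c → f a c * 𝟙 (D c w)) +_) (𝟙-asym w a) ⟨
      sum (λ c → f a c * 𝟙 (D w c)) + sum (λ c → f a c * 𝟙 (D c w)) + f a w
        ≡⟨ sum-split (f a) w ⟩
      sum (f a)
        ≡⟨ *-distribˡ-sum (𝟙 (D w a)) (𝟙 ∘ D a) ⟨
      𝟙 (D w a) * d⁺ D a
        ≡⟨ cong (𝟙 (D w a) *_) (d⁺≡n a) ⟩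
      𝟙 (D w a) * n
        ∎

  twice-transitive : ∀ w → 2 * transitiveFrom w + n ≡ n * n
  twice-transitive w = begin
    2 * transitiveFrom w + n
      ≡⟨ cong₂ (λ x y → 2 * x + y)
           (sum-cong-≗ (λ a → sum-cong-≗ (λ c → *-right-comm (𝟙 (D w a)) (𝟙 (D a c)) (𝟙 (D w c)))))
           (trans (sym (d⁺≡n w)) (sum-cong-≗ (λ a → sym (𝟙-idem (D w a))))) ⟩
    2 * sum (λ a → sum (λ c → 𝟙 (D w a) * 𝟙 (D w c) * 𝟙 (D a c))) + sum (λ a → 𝟙 (D w a) * 𝟙 (D w a))
      ≡⟨ sum-arcs-within (𝟙 ∘ D w) ⟩
    d⁺ D w * d⁺ D w
      ≡⟨ cong₂ _*_ (d⁺≡n w) (d⁺≡n w) ⟩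
    n * n
      ∎
    where open ≡-Reasoning

  twice-cyclic : ∀ w → 2 * cyclicThrough w ≡ n * n + n
  twice-cyclic w = +-cancelʳ-≡ (n * n) _ _ (begin
    2 * X + n * n              ≡⟨ cong (2 * X +_) (twice-transitive w) ⟨
    2 * X + (2 * Y + n)        ≡⟨ regroup X Y n ⟩
    2 * (Y + X) + n            ≡⟨ cong (λ x → 2 * x + n) (transitive+cyclic w) ⟩
    2 * (n * n) + n            ≡⟨ regroup′ (n * n) n ⟩
    n * n + n + n * n          ∎)
    where
    open ≡-Reasoning
    X = cyclicThrough w
    Y = transitiveFrom w
    regroup : ∀ x y n → 2 * x + (2 * y + n) ≡ 2 * (y + x) + n
    regroup = solve-∀
    regroup′ : ∀ x n → 2 * x + n ≡ x + n + x
    regroup′ = solve-∀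

common : ∀ {m} → Digraph m → Fin m → Fin m → ℕ
common D v w = sum (λ k → 𝟙 (D v k) * 𝟙 (D w k))

commonOut≡common : ∀ {m} (D : Digraph m) v w → commonOut D v w ≡ common D v w
commonOut≡common D v w = trans (countV≡sum (λ k → D v k ∧ D w k)) (sum-cong-≗ (λ k → 𝟙-∧ (D v k) (D w k)))

switchable : ∀ {m} → Digraph m → (v w a c : Fin m) → Bool
switchable D v w a c = D v a ∧ (D w a ∧ (D a c ∧ (D c v ∧ D c w)))

switchable⁻ : ∀ {m} (D : Digraph m) v w a c → switchable D v w a c ≡ true →
  (D v a ≡ true) × (D w a ≡ true) × (D a c ≡ true) × (D c v ≡ true) × (D c w ≡ true)
switchable⁻ D v w a c h
  with va , h₁ ← ∧-true⁻ (D v a) h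
  with wa , h₂ ← ∧-true⁻ (D w a) h₁
  with ac , h₃ ← ∧-true⁻ (D a c) h₂
  with cv , cw ← ∧-true⁻ (D c v) h₃ = va , wa , ac , cv , cw

switched : ∀ {m} → Digraph m → (v w a c : Fin m) → Bool
switched D v w a c = (D v a ∧ D a w) ∧ (D w c ∧ D c v)

-- A cyclic triangle w → a → c → w is switchable unless a ∉ N⁺(v) or c ∉ N⁻(v).
cyclic-cover : ∀ va wa ac cv cw →
  𝟙 wa * 𝟙 ac * 𝟙 cw
    ≤ 𝟙 (va ∧ (wa ∧ (ac ∧ (cv ∧ cw)))) + (𝟙 (not va) * 𝟙 wa * 𝟙 ac + 𝟙 (not cv) * 𝟙 cw * 𝟙 ac)
cyclic-cover _ false _ _ _ = z≤n
cyclic-cover _ true false _ _ = z≤n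
cyclic-cover _ true true _ false = z≤n
cyclic-cover true true true true true = s≤s z≤n
cyclic-cover true true true false true = s≤s z≤n
cyclic-cover false true true _ true = s≤s z≤n

module Arc (n : ℕ) (D : Digraph (suc (2 * n))) (isET : isEulerianTournament D ≡ true)
           (v w : Fin (suc (2 * n))) (vw : D v w ≡ true) where

  open EulerianTournament n D isET

  pathsVW pathsWV : ℕ
  pathsVW = sum (λ c → 𝟙 (D v c) * 𝟙 (D c w))
  pathsWV = sum (λ c → 𝟙 (D w c) * 𝟙 (D c v))

  common+pathsVW : common D v w + pathsVW + 1 ≡ n
  common+pathsVW = begin
    common D v w + pathsVW + 1           ≡⟨ cong (λ x → common D v w + pathsVW + 𝟙 x) vw ⟨
    common D v w + pathsVW + 𝟙 (D v w)   ≡⟨ sum-split (𝟙 ∘ D v) w ⟩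
    d⁺ D v                               ≡⟨ d⁺≡n v ⟩
    n                                    ∎
    where open ≡-Reasoning

  common+pathsWV : common D v w + pathsWV ≡ n
  common+pathsWV = begin
    common D v w + pathsWV
      ≡⟨ cong₂ _+_ (sum-cong-≗ (λ c → *-comm (𝟙 (D w c)) (𝟙 (D v c)))) (+-identityʳ pathsWV) ⟨
    sum (λ c → 𝟙 (D w c) * 𝟙 (D v c)) + (pathsWV + 𝟙 false)
      ≡⟨ cong (λ x → sum (λ c → 𝟙 (D w c) * 𝟙 (D v c)) + (pathsWV + 𝟙 x)) (asym vw) ⟨
    sum (λ c → 𝟙 (D w c) * 𝟙 (D v c)) + (pathsWV + 𝟙 (D w v))
      ≡⟨ +-assoc (sum (λ c → 𝟙 (D w c) * 𝟙 (D v c))) pathsWV (𝟙 (D w v)) ⟨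
    sum (λ c → 𝟙 (D w c) * 𝟙 (D v c)) + pathsWV + 𝟙 (D w v)
      ≡⟨ sum-split (𝟙 ∘ D w) v ⟩
    d⁺ D w
      ≡⟨ d⁺≡n w ⟩
    n ∎
    where open ≡-Reasoning

  common+out-w∖out-v : common D v w + sum (λ a → 𝟙 (not (D v a)) * 𝟙 (D w a)) ≡ n
  common+out-w∖out-v = begin
    common D v w + sum (λ a → 𝟙 (not (D v a)) * 𝟙 (D w a))
      ≡⟨ ∑-distrib-+ (λ a → 𝟙 (D v a) * 𝟙 (D w a)) (λ a → 𝟙 (not (D v a)) * 𝟙 (D w a)) ⟨
    sum (λ a → 𝟙 (D v a) * 𝟙 (D w a) + 𝟙 (not (D v a)) * 𝟙 (D w a))
      ≡⟨ sum-cong-≗ (λ a → trans (sym (*-distribʳ-+ (𝟙 (D w a)) (𝟙 (D v a)) (𝟙 (not (D v a)))))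
                                 (trans (cong (_* 𝟙 (D w a)) (𝟙-not (D v a))) (*-identityˡ (𝟙 (D w a))))) ⟩
    d⁺ D w
      ≡⟨ d⁺≡n w ⟩
    n ∎
    where open ≡-Reasoning

  common+in-w∖in-v : common D v w + sum (λ c → 𝟙 (not (D c v)) * 𝟙 (D c w)) ≡ n
  common+in-w∖in-v = begin
    common D v w + sum (λ c → 𝟙 (not (D c v)) * 𝟙 (D c w))
      ≡⟨ cong (common D v w +_) (sum-cong-≗ λ c → cong (_* 𝟙 (D c w)) (𝟙-not-in c)) ⟩
    common D v w + sum (λ c → (𝟙 (D v c) + 𝟙 (eqF c v)) * 𝟙 (D c w))
      ≡⟨ cong (common D v w +_) (sum-cong-≗ λ c → *-distribʳ-+ (𝟙 (D c w)) (𝟙 (D v c)) (𝟙 (eqF c v))) ⟩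
    common D v w + sum (λ c → 𝟙 (D v c) * 𝟙 (D c w) + 𝟙 (eqF c v) * 𝟙 (D c w))
      ≡⟨ cong (common D v w +_) (∑-distrib-+ (λ c → 𝟙 (D v c) * 𝟙 (D c w)) (λ c → 𝟙 (eqF c v) * 𝟙 (D c w))) ⟩
    common D v w + (pathsVW + sum (λ c → 𝟙 (eqF c v) * 𝟙 (D c w)))
      ≡⟨ cong (λ x → common D v w + (pathsVW + x)) (trans (sum-δ v (λ c → 𝟙 (D c w))) (cong 𝟙 vw)) ⟩
    common D v w + (pathsVW + 1)
      ≡⟨ +-assoc (common D v w) pathsVW 1 ⟨
    common D v w + pathsVW + 1
      ≡⟨ common+pathsVW ⟩
    n ∎
    where
    open ≡-Reasoning
    𝟙-not-in : ∀ c → 𝟙 (not (D c v)) ≡ 𝟙 (D v c) + 𝟙 (eqF c v)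
    𝟙-not-in c = +-cancelˡ-≡ (𝟙 (D c v)) _ _ (begin
      𝟙 (D c v) + 𝟙 (not (D c v))              ≡⟨ 𝟙-not (D c v) ⟩
      1                                        ≡⟨ 𝟙-trichotomy v c ⟨
      𝟙 (D v c) + 𝟙 (D c v) + 𝟙 (eqF c v)      ≡⟨ cong (_+ 𝟙 (eqF c v)) (+-comm (𝟙 (D v c)) (𝟙 (D c v))) ⟩
      𝟙 (D c v) + 𝟙 (D v c) + 𝟙 (eqF c v)      ≡⟨ +-assoc (𝟙 (D c v)) (𝟙 (D v c)) (𝟙 (eqF c v)) ⟩
      𝟙 (D c v) + (𝟙 (D v c) + 𝟙 (eqF c v))    ∎)

  switchables nonOutPaths nonInPaths : ℕ
  switchables = sum (λ a → sum (λ c → 𝟙 (switchable D v w a c)))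
  nonOutPaths = sum (λ a → sum (λ c → 𝟙 (not (D v a)) * 𝟙 (D w a) * 𝟙 (D a c)))
  nonInPaths = sum (λ a → sum (λ c → 𝟙 (not (D c v)) * 𝟙 (D c w) * 𝟙 (D a c)))

  cyclicThrough≤ : cyclicThrough w ≤ switchables + (nonOutPaths + nonInPaths)
  cyclicThrough≤ = begin
    cyclicThrough w
      ≤⟨ sum-mono-≤ (λ a → sum-mono-≤ (λ c → cyclic-cover (D v a) (D w a) (D a c) (D c v) (D c w))) ⟩
    sum (λ a → sum (λ c → 𝟙 (switchable D v w a c) + (r₁ a c + r₂ a c)))
      ≡⟨ sum-cong-≗ (λ a → trans (∑-distrib-+ (λ c → 𝟙 (switchable D v w a c)) (λ c → r₁ a c + r₂ a c))
                                  (cong (sum (λ c → 𝟙 (switchable D v w a c)) +_) (∑-distrib-+ (r₁ a) (r₂ a)))) ⟩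
    sum (λ a → sum (λ c → 𝟙 (switchable D v w a c)) + (sum (r₁ a) + sum (r₂ a)))
      ≡⟨ ∑-distrib-+ (λ a → sum (λ c → 𝟙 (switchable D v w a c))) (λ a → sum (r₁ a) + sum (r₂ a)) ⟩
    switchables + sum (λ a → sum (r₁ a) + sum (r₂ a))
      ≡⟨ cong (switchables +_) (∑-distrib-+ (λ a → sum (r₁ a)) (λ a → sum (r₂ a))) ⟩
    switchables + (nonOutPaths + nonInPaths) ∎
    where
    open ≤-Reasoning
    r₁ r₂ : Fin (suc (2 * n)) → Fin (suc (2 * n)) → ℕ
    r₁ a c = 𝟙 (not (D v a)) * 𝟙 (D w a) * 𝟙 (D a c)
    r₂ a c = 𝟙 (not (D c v)) * 𝟙 (D c w) * 𝟙 (D a c)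

  nonOutPaths≡ : ∀ s → common D v w + s ≡ n → nonOutPaths ≡ s * n
  nonOutPaths≡ s deficit = begin
    nonOutPaths
      ≡⟨ sum-cong-≗ (λ a → trans (sym (*-distribˡ-sum (𝟙 (not (D v a)) * 𝟙 (D w a)) (𝟙 ∘ D a)))
                                  (cong (𝟙 (not (D v a)) * 𝟙 (D w a) *_) (d⁺≡n a))) ⟩
    sum (λ a → 𝟙 (not (D v a)) * 𝟙 (D w a) * n)
      ≡⟨ *-distribʳ-sum n (λ a → 𝟙 (not (D v a)) * 𝟙 (D w a)) ⟨
    sum (λ a → 𝟙 (not (D v a)) * 𝟙 (D w a)) * n
      ≡⟨ cong (_* n) (+-cancelˡ-≡ (common D v w) _ s (trans common+out-w∖out-v (sym deficit))) ⟩
    s * n ∎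
    where open ≡-Reasoning

  nonInPaths≡ : ∀ s → common D v w + s ≡ n → nonInPaths ≡ s * n
  nonInPaths≡ s deficit = begin
    nonInPaths
      ≡⟨ ∑-comm (λ a c → 𝟙 (not (D c v)) * 𝟙 (D c w) * 𝟙 (D a c)) ⟩
    sum (λ c → sum (λ a → 𝟙 (not (D c v)) * 𝟙 (D c w) * 𝟙 (D a c)))
      ≡⟨ sum-cong-≗ (λ c → trans (sym (*-distribˡ-sum (𝟙 (not (D c v)) * 𝟙 (D c w)) (λ a → 𝟙 (D a c))))
                                  (cong (𝟙 (not (D c v)) * 𝟙 (D c w) *_) (d⁻≡n c))) ⟩
    sum (λ c → 𝟙 (not (D c v)) * 𝟙 (D c w) * n)
      ≡⟨ *-distribʳ-sum n (λ c → 𝟙 (not (D c v)) * 𝟙 (D c w)) ⟨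
    sum (λ c → 𝟙 (not (D c v)) * 𝟙 (D c w)) * n
      ≡⟨ cong (_* n) (+-cancelˡ-≡ (common D v w) _ s (trans common+in-w∖in-v (sym deficit))) ⟩
    s * n ∎
    where open ≡-Reasoning

  switchable-bound : ∀ s → common D v w + s ≡ n → n * n + n ≤ 2 * switchables + 4 * (s * n)
  switchable-bound s deficit = begin
    n * n + n                                        ≡⟨ twice-cyclic w ⟨
    2 * cyclicThrough w                              ≤⟨ *-monoʳ-≤ 2 cyclicThrough≤ ⟩
    2 * (switchables + (nonOutPaths + nonInPaths))   ≡⟨ cong₂ (λ x y → 2 * (switchables + (x + y)))
                                                          (nonOutPaths≡ s deficit) (nonInPaths≡ s deficit) ⟩
    2 * (switchables + (s * n + s * n))              ≡⟨ regroup switchables (s * n) ⟩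
    2 * switchables + 4 * (s * n)                    ∎
    where
    open ≤-Reasoning
    regroup : ∀ x y → 2 * (x + (y + y)) ≡ 2 * x + 4 * y
    regroup = solve-∀

  switched-count : ∀ s → common D v w + suc s ≡ n →
    sum (λ a → sum (λ c → 𝟙 (switched D v w a c))) ≡ s * suc s
  switched-count s deficit = begin
    sum (λ a → sum (λ c → 𝟙 (switched D v w a c)))
      ≡⟨ sum-cong-≗ (λ a → sum-cong-≗ (λ c → 𝟙-∧ (D v a ∧ D a w) (D w c ∧ D c v))) ⟩
    sum (λ a → sum (λ c → 𝟙 (D v a ∧ D a w) * 𝟙 (D w c ∧ D c v)))
      ≡⟨ sum-cong-≗ (λ a → *-distribˡ-sum (𝟙 (D v a ∧ D a w)) (λ c → 𝟙 (D w c ∧ D c v))) ⟨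
    sum (λ a → 𝟙 (D v a ∧ D a w) * sum (λ c → 𝟙 (D w c ∧ D c v)))
      ≡⟨ *-distribʳ-sum (sum (λ c → 𝟙 (D w c ∧ D c v))) (λ a → 𝟙 (D v a ∧ D a w)) ⟨
    sum (λ a → 𝟙 (D v a ∧ D a w)) * sum (λ c → 𝟙 (D w c ∧ D c v))
      ≡⟨ cong₂ _*_ (sum-cong-≗ (λ a → 𝟙-∧ (D v a) (D a w))) (sum-cong-≗ (λ c → 𝟙-∧ (D w c) (D c v))) ⟩
    pathsVW * pathsWV
      ≡⟨ cong₂ _*_ pathsVW≡ pathsWV≡ ⟩
    s * suc s ∎
    where
    open ≡-Reasoning
    pathsVW≡ : pathsVW ≡ s
    pathsVW≡ = +-cancelˡ-≡ (common D v w) pathsVW s (+-cancelʳ-≡ 1 _ _ (begin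
      common D v w + pathsVW + 1   ≡⟨ common+pathsVW ⟩
      n                            ≡⟨ deficit ⟨
      common D v w + suc s         ≡⟨ +-suc (common D v w) s ⟩
      suc (common D v w + s)       ≡⟨ +-comm 1 (common D v w + s) ⟩
      common D v w + s + 1         ∎))
    pathsWV≡ : pathsWV ≡ suc s
    pathsWV≡ = +-cancelˡ-≡ (common D v w) pathsWV (suc s) (trans common+pathsWV (sym deficit))

-- Reversing a cyclic triangle

inside : ∀ {m} → (Fin m → Bool) → Fin m → Fin m → Bool
inside S i j = S i ∧ (S j ∧ not (eqF i j))

reverseInside : ∀ {m} → (Fin m → Bool) → Digraph m → Digraph m
reverseInside S D i j = inside S i j xor D i j

module _ {m} (S : Fin m → Bool) where

  inside-irrefl : ∀ i → inside S i i ≡ false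
  inside-irrefl i rewrite eqF-refl i | ∧-zeroʳ (S i) = ∧-zeroʳ (S i)

  inside-sym : ∀ i j → inside S i j ≡ inside S j i
  inside-sym i j rewrite eqF-sym i j with S i | S j
  ... | true | true = refl
  ... | true | false = refl
  ... | false | true = refl
  ... | false | false = refl

  reverseInside-involutive : ∀ D i j → reverseInside S (reverseInside S D) i j ≡ D i j
  reverseInside-involutive D i j = xor-involutive (inside S i j) (D i j)

  reverseInside-outside : ∀ {u} → S u ≡ false → ∀ D k → reverseInside S D u k ≡ D u k
  reverseInside-outside {u} u∉S D k rewrite u∉S = refl

  reverseInside-isTournament : ∀ D → isTournament D ≡ true → isTournament (reverseInside S D) ≡ true
  reverseInside-isTournament D isT = isTournament⁺ (reverseInside S D)
    (λ u → trans (cong (_xor D u u) (inside-irrefl u)) (loopless u))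
    (λ u v u≢v → subst (λ x → 𝟙 (inside S u v xor D u v) + 𝟙 (x xor D v u) ≡ 1) (inside-sym u v)
                       (𝟙-xor-pair (inside S u v) (exactly-one u≢v)))
    where open Tournament D isT

triangle : ∀ {m} → Fin m → Fin m → Fin m → Fin m → Bool
triangle a b c k = eqF k a ∨ (eqF k b ∨ eqF k c)

module CyclicTriangle {m} (E : Digraph m) (isT : isTournament E ≡ true) {a b c : Fin m}
                      (ab : E a b ≡ true) (bc : E b c ≡ true) (ca : E c a ≡ true) where

  open Tournament E isT

  T : Fin m → Bool
  T = triangle a b c

  E′ : Digraph m
  E′ = reverseInside T E

  triangle-cases : ∀ {u} → T u ≡ true → u ≡ a ⊎ u ≡ b ⊎ u ≡ c
  triangle-cases {u} u∈T with u Fin.≟ a | u Fin.≟ b | u Fin.≟ c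
  ... | yes u=a | _ | _ = inj₁ u=a
  ... | no _ | yes u=b | _ = inj₂ (inj₁ u=b)
  ... | no _ | no _ | yes u=c = inj₂ (inj₂ u=c)
  ... | no _ | no _ | no _ with () ← u∈T

  𝟙-triangle : ∀ k → 𝟙 (T k) ≡ 𝟙 (eqF k a) + 𝟙 (eqF k b) + 𝟙 (eqF k c)
  𝟙-triangle k with k Fin.≟ a | k Fin.≟ b | k Fin.≟ c
  ... | yes refl | no _ | no _ = refl
  ... | no _ | yes refl | no _ = refl
  ... | no _ | no _ | yes refl = refl
  ... | no _ | no _ | no _ = refl
  ... | yes refl | yes refl | _ = contradiction refl (arc⇒≢ ab)
  ... | yes refl | no _ | yes refl = contradiction refl (arc⇒≢ ca)
  ... | no _ | yes refl | yes refl = contradiction refl (arc⇒≢ bc)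

  sum-triangle : ∀ f → sum (λ k → 𝟙 (T k) * f k) ≡ f a + f b + f c
  sum-triangle f = begin
    sum (λ k → 𝟙 (T k) * f k)
      ≡⟨ sum-cong-≗ (λ k → trans (cong (_* f k) (𝟙-triangle k)) (distrib₃ (f k) (eqF k a) (eqF k b) (eqF k c))) ⟩
    sum (λ k → 𝟙 (eqF k a) * f k + 𝟙 (eqF k b) * f k + 𝟙 (eqF k c) * f k)
      ≡⟨ ∑-distrib-+ (λ k → 𝟙 (eqF k a) * f k + 𝟙 (eqF k b) * f k) _ ⟩
    sum (λ k → 𝟙 (eqF k a) * f k + 𝟙 (eqF k b) * f k) + sum (λ k → 𝟙 (eqF k c) * f k)
      ≡⟨ cong (_+ _) (∑-distrib-+ (λ k → 𝟙 (eqF k a) * f k) _) ⟩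
    sum (λ k → 𝟙 (eqF k a) * f k) + sum (λ k → 𝟙 (eqF k b) * f k) + sum (λ k → 𝟙 (eqF k c) * f k)
      ≡⟨ cong₂ _+_ (cong₂ _+_ (sum-δ a f) (sum-δ b f)) (sum-δ c f) ⟩
    f a + f b + f c
      ∎
    where
    open ≡-Reasoning
    distrib₃ : ∀ x p q r → (𝟙 p + 𝟙 q + 𝟙 r) * x ≡ 𝟙 p * x + 𝟙 q * x + 𝟙 r * x
    distrib₃ x p q r = trans (*-distribʳ-+ x (𝟙 p + 𝟙 q) (𝟙 r)) (cong (_+ 𝟙 r * x) (*-distribʳ-+ x (𝟙 p) (𝟙 q)))

  sum-inside : ∀ u → T u ≡ true → ∀ f → sum (λ k → 𝟙 (inside T u k) * f k) + f u ≡ f a + f b + f c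
  sum-inside u u∈T f = begin
    sum (λ k → 𝟙 (inside T u k) * f k) + f u
      ≡⟨ cong (sum (λ k → 𝟙 (inside T u k) * f k) +_) (sum-δ u f) ⟨
    sum (λ k → 𝟙 (inside T u k) * f k) + sum (λ k → 𝟙 (eqF k u) * f k)
      ≡⟨ ∑-distrib-+ (λ k → 𝟙 (inside T u k) * f k) _ ⟨
    sum (λ k → 𝟙 (inside T u k) * f k + 𝟙 (eqF k u) * f k)
      ≡⟨ sum-cong-≗ (λ k → trans (cong (_* f k) (sym (row k)))
                                 (*-distribʳ-+ (f k) (𝟙 (inside T u k)) (𝟙 (eqF k u)))) ⟨
    sum (λ k → 𝟙 (T k) * f k)
      ≡⟨ sum-triangle f ⟩
    f a + f b + f c
      ∎
    where
    open ≡-Reasoning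
    row : ∀ k → 𝟙 (inside T u k) + 𝟙 (eqF k u) ≡ 𝟙 (T k)
    row k rewrite u∈T | eqF-sym u k with k Fin.≟ u
    ... | yes refl rewrite u∈T = refl
    ... | no _ rewrite ∧-identityʳ (T k) = +-identityʳ (𝟙 (T k))

  out-cycle : ∀ {u} → T u ≡ true → 𝟙 (E u a) + 𝟙 (E u b) + 𝟙 (E u c) ≡ 1
  out-cycle {u} u∈T with triangle-cases {u} u∈T
  ... | inj₁ refl rewrite loopless a | ab | asym ca = refl
  ... | inj₂ (inj₁ refl) rewrite asym ab | loopless b | bc = refl
  ... | inj₂ (inj₂ refl) rewrite ca | asym bc | loopless c = refl

  d⁺-reverse : ∀ u → d⁺ E′ u ≡ d⁺ E u
  d⁺-reverse u with T u Data.Bool.≟ true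
  ... | no u∉T = sum-cong-≗ (cong 𝟙 ∘ reverseInside-outside T (¬-not u∉T) E)
  ... | yes u∈T = +-cancelʳ-≡ 2 _ _ (begin
    d⁺ E′ u + 2                                              ≡⟨ cong (λ x → d⁺ E′ u + 2 * x) out-inside ⟨
    d⁺ E′ u + 2 * sum (λ k → 𝟙 (inside T u k) * 𝟙 (E u k))  ≡⟨ sum-𝟙-xor (inside T u) (E u) ⟩
    sum (𝟙 ∘ inside T u) + d⁺ E u                            ≡⟨ cong (_+ d⁺ E u) size-inside ⟩
    2 + d⁺ E u                                               ≡⟨ +-comm 2 (d⁺ E u) ⟩
    d⁺ E u + 2                                               ∎)
    where
    open ≡-Reasoning
    out : ℕ
    out-inside : out ≡ 1
    out = sum (λ k → 𝟙 (inside T u k) * 𝟙 (E u k))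
    out-inside = begin
      out                    ≡⟨ +-identityʳ out ⟨
      out + 𝟙 false          ≡⟨ cong (λ x → out + 𝟙 x) (loopless u) ⟨
      out + 𝟙 (E u u)                     ≡⟨ sum-inside u u∈T (𝟙 ∘ E u) ⟩
      𝟙 (E u a) + 𝟙 (E u b) + 𝟙 (E u c)   ≡⟨ out-cycle u∈T ⟩
      1                                   ∎
    size-inside : sum (𝟙 ∘ inside T u) ≡ 2
    size-inside = begin
      sum (𝟙 ∘ inside T u)                    ≡⟨ sum-cong-≗ (λ k → *-identityʳ (𝟙 (inside T u k))) ⟨
      sum (λ k → 𝟙 (inside T u k) * 1)       ≡⟨ +-cancelʳ-≡ 1 (sum (λ k → 𝟙 (inside T u k) * 1)) 2
                                                    (sum-inside u u∈T (λ _ → 1)) ⟩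
      2                                       ∎

  isTournament-reverse : isTournament E′ ≡ true
  isTournament-reverse = reverseInside-isTournament T E isT

  a∈T : T a ≡ true
  a∈T rewrite eqF-refl a = refl

  b∈T : T b ≡ true
  b∈T rewrite eqF-refl b = ∨-zeroʳ (eqF b a)

  c∈T : T c ≡ true
  c∈T rewrite eqF-refl c | ∨-zeroʳ (eqF c b) = ∨-zeroʳ (eqF c a)

  reversed : ∀ {x y} → T x ≡ true → T y ≡ true → E x y ≡ true → E′ y x ≡ true
  reversed {x} {y} x∈T y∈T xy rewrite y∈T | x∈T | eqF-≢ (arc⇒≢ xy ∘ sym) | asym xy = refl

regular-d⁻ : ∀ n (D : Digraph (suc (2 * n))) → isTournament D ≡ true → ∀ u → d⁺ D u ≡ n → d⁻ D u ≡ n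
regular-d⁻ n D isT u d⁺≡n = +-cancelˡ-≡ n _ _ (+-cancelʳ-≡ 1 _ _ (begin
  n + d⁻ D u + 1         ≡⟨ cong (λ x → x + d⁻ D u + 1) d⁺≡n ⟨
  d⁺ D u + d⁻ D u + 1    ≡⟨ Tournament.d⁺+d⁻ D isT u ⟩
  suc (2 * n)            ≡⟨ +-comm 1 (2 * n) ⟩
  n + (n + 0) + 1        ≡⟨ cong (λ x → n + x + 1) (+-identityʳ n) ⟩
  n + n + 1              ∎))
  where open ≡-Reasoning

reverseCycle-isEulerianTournament : ∀ n (E : Digraph (suc (2 * n))) → isEulerianTournament E ≡ true →
  ∀ {a b c} → E a b ≡ true → E b c ≡ true → E c a ≡ true →
  isEulerianTournament (reverseInside (triangle a b c) E) ≡ true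
reverseCycle-isEulerianTournament n E isET ab bc ca =
  ∧-true⁺ isTournament-reverse
    (isEulerian⁺ E′ λ u → trans (d⁺E′≡n u) (sym (regular-d⁻ n E′ isTournament-reverse u (d⁺E′≡n u))))
  where
  open EulerianTournament n E isET using (isT; d⁺≡n)
  open CyclicTriangle E isT ab bc ca using (E′; d⁺-reverse; isTournament-reverse)
  d⁺E′≡n : ∀ u → d⁺ E′ u ≡ n
  d⁺E′≡n u = trans (d⁺-reverse u) (d⁺≡n u)


module Switch (n : ℕ) (E : Digraph (suc (2 * n))) (isET : isEulerianTournament E ≡ true)
              (v w a c : Fin (suc (2 * n))) (vw : E v w ≡ true)
              (va : E v a ≡ true) (wa : E w a ≡ true) (ac : E a c ≡ true) (cv : E c v ≡ true) (cw : E c w ≡ true)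
              where

  open EulerianTournament n E isET using (isT)
  open Tournament E isT

  open CyclicTriangle E isT wa ac cw public
    using (T; E′) renaming (a∈T to w∈T; b∈T to a∈T)
  open CyclicTriangle E isT wa ac cw
    using (c∈T; reversed; sum-inside)

  v∉T : T v ≡ false
  v∉T rewrite eqF-≢ (arc⇒≢ vw) | eqF-≢ (arc⇒≢ va) | eqF-≢ (arc⇒≢ cv ∘ sym) = refl

  row-v : ∀ k → E′ v k ≡ E v k
  row-v = reverseInside-outside T v∉T E

  E′-isEulerianTournament : isEulerianTournament E′ ≡ true
  E′-isEulerianTournament = reverseCycle-isEulerianTournament n E isET wa ac cw

  E′-vw : E′ v w ≡ true
  E′-vw = trans (row-v w) vw

  E′-switched : switched E′ v w a c ≡ true
  E′-switched rewrite row-v a | va | reversed w∈T a∈T wa | reversed c∈T w∈T cw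
                    | inside-sym T c v | v∉T | cv = refl

  common-E′ : common E′ v w + 1 ≡ common E v w
  common-E′ = +-cancelʳ-≡ 1 _ _ (begin
    common E′ v w + 1 + 1
      ≡⟨ +-assoc (common E′ v w) 1 1 ⟩
    common E′ v w + 2 * 1
      ≡⟨ cong (λ x → common E′ v w + 2 * x) inward≡1 ⟨
    common E′ v w + 2 * inward
      ≡⟨ cong (_+ 2 * inward) (sum-cong-≗ (λ k → cong (λ x → 𝟙 x * 𝟙 (E′ w k)) (row-v k))) ⟩
    sum (λ k → 𝟙 (E v k) * 𝟙 (inside T w k xor E w k)) + 2 * inward
      ≡⟨ sum-𝟙-∧-xor (E v) (inside T w) (E w) ⟩
    sum (λ k → 𝟙 (inside T w k) * 𝟙 (E v k)) + common E v w
      ≡⟨ cong (_+ common E v w) outward≡1 ⟩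
    1 + common E v w
      ≡⟨ +-comm 1 (common E v w) ⟩
    common E v w + 1 ∎)
    where
    open ≡-Reasoning
    inward : ℕ
    inward = sum (λ k → 𝟙 (inside T w k) * (𝟙 (E v k) * 𝟙 (E w k)))
    inward≡1 : inward ≡ 1
    inward≡1 with sum-inside w w∈T (λ k → 𝟙 (E v k) * 𝟙 (E w k))
    ... | eq rewrite vw | loopless w | va | wa | asym cv = trans (sym (+-identityʳ inward)) eq
    outward≡1 : sum (λ k → 𝟙 (inside T w k) * 𝟙 (E v k)) ≡ 1
    outward≡1 with sum-inside w w∈T (𝟙 ∘ E v)
    ... | eq rewrite vw | va | asym cv = +-cancelʳ-≡ 1 _ _ eq

-- Counting by levels

_≐_ : ∀ {m} → Digraph m → Digraph m → Set
D ≐ D′ = ∀ i j → D i j ≡ D′ i j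

module _ {m} {D D′ : Digraph m} (D≐D′ : D ≐ D′) where

  isEulerianTournament-cong : isEulerianTournament D ≡ isEulerianTournament D′
  isEulerianTournament-cong = cong₂ _∧_
    (allV-cong λ u → allV-cong λ v →
      cong₂ (λ x y → if eqF u v then not x else ((x ∧ not y) ∨ (not x ∧ y))) (D≐D′ u v) (D≐D′ v u))
    (allV-cong λ u → cong₂ (λ x y → ⌊ x ≟ y ⌋) (countV-cong (D≐D′ u)) (countV-cong (λ k → D≐D′ k u)))

  common-cong : ∀ v w → common D v w ≡ common D′ v w
  common-cong v w = sum-cong-≗ (λ k → cong₂ (λ x y → 𝟙 x * 𝟙 y) (D≐D′ v k) (D≐D′ w k))

  switchable-cong : ∀ v w a c → switchable D v w a c ≡ switchable D′ v w a c
  switchable-cong v w a c =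
    cong₂ _∧_ (D≐D′ v a)
      (cong₂ _∧_ (D≐D′ w a) (cong₂ _∧_ (D≐D′ a c) (cong₂ _∧_ (D≐D′ c v) (D≐D′ c w))))

  switched-cong : ∀ v w a c → switched D v w a c ≡ switched D′ v w a c
  switched-cong v w a c =
    cong₂ _∧_ (cong₂ _∧_ (D≐D′ v a) (D≐D′ a w)) (cong₂ _∧_ (D≐D′ w c) (D≐D′ c v))

module Levels (n : ℕ) (v w : Fin (suc (2 * n))) where

  Digraphₙ : Set
  Digraphₙ = Digraph (suc (2 * n))

  level : ℕ → Digraphₙ → Bool
  level s D = isEulerianTournament D ∧ (D v w ∧ ⌊ common D v w + s ≟ n ⌋)

  level⁻ : ∀ s D → level s D ≡ true →
    (isEulerianTournament D ≡ true) × (D v w ≡ true) × (common D v w + s ≡ n)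
  level⁻ s D lev with ∧-true⁻ (isEulerianTournament D) lev
  ... | isET , rest with ∧-true⁻ (D v w) rest
  ... | vw , deficit = isET , vw , ⌊⌋-sound (common D v w + s ≟ n) deficit

  level⁺ : ∀ {s D} → isEulerianTournament D ≡ true → D v w ≡ true → common D v w + s ≡ n → level s D ≡ true
  level⁺ {s} {D} isET vw deficit = ∧-true⁺ isET (∧-true⁺ vw (⌊⌋-true (common D v w + s ≟ n) deficit))

  level-cong : ∀ s {D D′} → D ≐ D′ → level s D ≡ level s D′
  level-cong s D≐D′ = cong₂ _∧_ (isEulerianTournament-cong D≐D′)
    (cong₂ _∧_ (D≐D′ v w) (cong (λ x → ⌊ x + s ≟ n ⌋) (common-cong D≐D′ v w)))

  switchAt : Fin (suc (2 * n)) → Fin (suc (2 * n)) → Digraphₙ → Digraphₙ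
  switchAt a c = reverseInside (triangle w a c)

  levelSize : ℕ → ℕ
  levelSize s = ∑ᴸ (𝟙 ∘ level s) (allDigraphs _)

  switchableAt : ℕ → Digraphₙ → Fin (suc (2 * n)) → Fin (suc (2 * n)) → ℕ
  switchableAt s D a c = 𝟙 (level s D ∧ switchable D v w a c)

  switchableCount : ℕ → ℕ
  switchableCount s = ∑ᴸ (λ D → sum (λ a → sum (switchableAt s D a))) (allDigraphs _)

  level-switchable-bound : ∀ s D →
    𝟙 (level s D) * (n * n + n) ≤ 2 * sum (λ a → sum (switchableAt s D a)) + 𝟙 (level s D) * (4 * (s * n))
  level-switchable-bound s D with level s D in lev
  ... | false = z≤n
  ... | true with level⁻ s D lev
  ... | isET , vw , deficit = begin
    1 * (n * n + n)                                                    ≡⟨ *-identityˡ (n * n + n) ⟩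
    n * n + n                                                          ≤⟨ Arc.switchable-bound n D isET v w vw s deficit ⟩
    2 * sum (λ a → sum (λ c → 𝟙 (switchable D v w a c))) + 4 * (s * n)
      ≡⟨ cong (2 * sum (λ a → sum (λ c → 𝟙 (switchable D v w a c))) +_) (*-identityˡ (4 * (s * n))) ⟨
    2 * sum (λ a → sum (λ c → 𝟙 (switchable D v w a c))) + 1 * (4 * (s * n))   ∎
    where open ≤-Reasoning

  switch-bound : ∀ s D a c → switchableAt s (switchAt a c D) a c ≤ 𝟙 (level (suc s) D ∧ switched D v w a c)
  switch-bound s D a c = 𝟙-mono transport
    where
    E : Digraphₙ
    E = switchAt a c D
    transport : level s E ∧ switchable E v w a c ≡ true → level (suc s) D ∧ switched D v w a c ≡ true
    transport h with ∧-true⁻ (level s E) h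
    ... | lev , config with level⁻ s E lev | switchable⁻ E v w a c config
    ... | isET , vw , deficit | va , wa , ac , cv , cw =
      trans (cong₂ _∧_ (level-cong (suc s) D≐E′) (switched-cong D≐E′ v w a c))
            (∧-true⁺ {level (suc s) E′} (level⁺ {suc s} {E′} E′-isEulerianTournament E′-vw deficit′) E′-switched)
      where
      open Switch n E isET v w a c vw va wa ac cv cw
      D≐E′ : D ≐ E′
      D≐E′ i j = sym (reverseInside-involutive (triangle w a c) D i j)
      deficit′ : common E′ v w + suc s ≡ n
      deficit′ = trans (sym (+-assoc (common E′ v w) 1 s)) (trans (cong (_+ s) common-E′) deficit)

  level-switched-count : ∀ s D →
    sum (λ a → sum (λ c → 𝟙 (level (suc s) D ∧ switched D v w a c))) ≡ 𝟙 (level (suc s) D) * (s * suc s)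
  level-switched-count s D with level (suc s) D in lev
  ... | false = begin
    sum {suc (2 * n)} (λ a → sum {suc (2 * n)} (λ c → 0))
      ≡⟨ sum-cong-≗ {suc (2 * n)} (λ a → sum-zero (suc (2 * n))) ⟩
    sum {suc (2 * n)} (λ a → 0)                            ≡⟨ sum-zero (suc (2 * n)) ⟩
    0                                                      ∎
    where open ≡-Reasoning
  ... | true with level⁻ (suc s) D lev
  ... | isET , vw , deficit =
    trans (Arc.switched-count n D isET v w vw s deficit) (sym (*-identityˡ (s * suc s)))

  levelSize-bound : ∀ s →
    levelSize s * (n * n + n) ≤ 2 * switchableCount s + levelSize s * (4 * (s * n))
  levelSize-bound s = begin
    levelSize s * (n * n + n)
      ≡⟨ *-distribʳ-∑ᴸ (𝟙 ∘ level s) (n * n + n) (allDigraphs _) ⟨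
    ∑ᴸ (λ D → 𝟙 (level s D) * (n * n + n)) (allDigraphs _)
      ≤⟨ ∑ᴸ-mono-≤ (level-switchable-bound s) (allDigraphs _) ⟩
    ∑ᴸ (λ D → 2 * Sw D + 𝟙 (level s D) * (4 * (s * n))) (allDigraphs _)
      ≡⟨ ∑ᴸ-distrib-+ (λ D → 2 * Sw D) (λ D → 𝟙 (level s D) * (4 * (s * n))) (allDigraphs _) ⟩
    ∑ᴸ (λ D → 2 * Sw D) (allDigraphs _) + ∑ᴸ (λ D → 𝟙 (level s D) * (4 * (s * n))) (allDigraphs _)
      ≡⟨ cong₂ _+_ (*-distribˡ-∑ᴸ 2 Sw (allDigraphs _))
                   (*-distribʳ-∑ᴸ (𝟙 ∘ level s) (4 * (s * n)) (allDigraphs _)) ⟩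
    2 * switchableCount s + levelSize s * (4 * (s * n))
      ∎
    where
    open ≤-Reasoning
    Sw : Digraphₙ → ℕ
    Sw D = sum (λ a → sum (switchableAt s D a))

  switchableCount-bound : ∀ s → switchableCount s ≤ levelSize (suc s) * (s * suc s)
  switchableCount-bound s = begin
    switchableCount s
      ≡⟨ ∑ᴸ-sum²-comm (switchableAt s) (allDigraphs _) ⟩
    sum (λ a → sum (λ c → ∑ᴸ (λ D → switchableAt s D a c) (allDigraphs _)))
      ≡⟨ sum-cong-≗ (λ a → sum-cong-≗ (λ c →
           -- reversing the triangle on {w, a, c} permutes all digraphs
           allDigraphs-xor-invariant _ (inside (triangle w a c)) (λ D → switchableAt s D a c) (respects a c))) ⟩
    sum (λ a → sum (λ c → ∑ᴸ (λ D → switchableAt s (switchAt a c D) a c) (allDigraphs _)))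
      ≡⟨ ∑ᴸ-sum²-comm (λ D a c → switchableAt s (switchAt a c D) a c) (allDigraphs _) ⟨
    ∑ᴸ (λ D → sum (λ a → sum (λ c → switchableAt s (switchAt a c D) a c))) (allDigraphs _)
      ≤⟨ ∑ᴸ-mono-≤ (λ D → sum-mono-≤ (λ a → sum-mono-≤ (switch-bound s D a))) (allDigraphs _) ⟩
    ∑ᴸ (λ D → sum (λ a → sum (λ c → 𝟙 (level (suc s) D ∧ switched D v w a c)))) (allDigraphs _)
      ≡⟨ ∑ᴸ-cong (level-switched-count s) (allDigraphs _) ⟩
    ∑ᴸ (λ D → 𝟙 (level (suc s) D) * (s * suc s)) (allDigraphs _)
      ≡⟨ *-distribʳ-∑ᴸ (𝟙 ∘ level (suc s)) (s * suc s) (allDigraphs _) ⟩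
    levelSize (suc s) * (s * suc s)
      ∎
    where
    open ≤-Reasoning
    respects : ∀ a c → Respects (Pointwise (Pointwise _≡_)) (λ D → switchableAt s D a c)
    respects a c D≐D′ = cong 𝟙 (cong₂ _∧_ (level-cong s D≐D′) (switchable-cong D≐D′ v w a c))


  levelSize-recurrence : ∀ s x → x + 4 * (s * n) ≡ n * n + n →
    levelSize s * x ≤ 2 * (levelSize (suc s) * (s * suc s))
  levelSize-recurrence s x split = +-cancelʳ-≤ (levelSize s * (4 * (s * n))) _ _ (begin
    levelSize s * x + levelSize s * (4 * (s * n))
      ≡⟨ *-distribˡ-+ (levelSize s) x (4 * (s * n)) ⟨
    levelSize s * (x + 4 * (s * n))
      ≡⟨ cong (levelSize s *_) split ⟩
    levelSize s * (n * n + n)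
      ≤⟨ levelSize-bound s ⟩
    2 * switchableCount s + levelSize s * (4 * (s * n))
      ≤⟨ +-monoˡ-≤ (levelSize s * (4 * (s * n))) (*-monoʳ-≤ 2 (switchableCount-bound s)) ⟩
    2 * (levelSize (suc s) * (s * suc s)) + levelSize s * (4 * (s * n))
      ∎)
    where open ≤-Reasoning

  length-𝓔 : length (𝓔 n) ≡ ∑ᴸ (𝟙 ∘ isEulerianTournament) (allDigraphs (suc (2 * n)))
  length-𝓔 = length-filter isEulerianTournament (allDigraphs (suc (2 * n)))

  levelSize≤length-𝓔 : ∀ s → levelSize s ≤ length (𝓔 n)
  levelSize≤length-𝓔 s = subst (levelSize s ≤_) (sym length-𝓔)
    (∑ᴸ-mono-≤ (λ D → 𝟙-mono (proj₁ ∘ ∧-true⁻ (isEulerianTournament D))) (allDigraphs (suc (2 * n))))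

  length-𝓔vw : 1 ≤ n → length (𝓔vw n v w) ≡ levelSize 1
  length-𝓔vw (s≤s z≤n) = begin
    length (𝓔vw n v w)
      ≡⟨ length-filter Q (𝓔 n) ⟩
    ∑ᴸ (𝟙 ∘ Q) (𝓔 n)
      ≡⟨ ∑ᴸ-filter isEulerianTournament (𝟙 ∘ Q) (allDigraphs _) ⟩
    ∑ᴸ (λ D → 𝟙 (isEulerianTournament D) * 𝟙 (Q D)) (allDigraphs _)
      ≡⟨ ∑ᴸ-cong (λ D → trans (sym (𝟙-∧ (isEulerianTournament D) (Q D)))
                              (cong (λ b → 𝟙 (isEulerianTournament D ∧ (D v w ∧ b))) (deficit D)))
                 (allDigraphs _) ⟩
    levelSize 1
      ∎
    where
    open ≡-Reasoning
    Q : Digraph (suc (2 * n)) → Bool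
    Q D = D v w ∧ ⌊ commonOut D v w ≟ n ∸ 1 ⌋
    deficit : ∀ D → ⌊ commonOut D v w ≟ n ∸ 1 ⌋ ≡ ⌊ common D v w + 1 ≟ n ⌋
    deficit D = ⌊⌋-cong (commonOut D v w ≟ n ∸ 1) (common D v w + 1 ≟ n)
      (λ eq → trans (+-comm (common D v w) 1) (cong suc (trans (sym (commonOut≡common D v w)) eq)))
      (λ eq → trans (commonOut≡common D v w) (suc-injective (trans (+-comm 1 (common D v w)) eq)))

-- The estimate

fourth-power≤ : ∀ t → (16 + t) ^ 4 ≤ 4 * ((16 + t) * (13 + t)) * ((16 + t) * (9 + t))
fourth-power≤ t = begin
  (16 + t) ^ 4                                        ≡⟨ fourth-power (16 + t) ⟩
  (16 + t) * (16 + t) * ((16 + t) * (16 + t))         ≤⟨ *-monoʳ-≤ ((16 + t) * (16 + t)) square≤ ⟩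
  (16 + t) * (16 + t) * (4 * ((13 + t) * (9 + t)))    ≡⟨ regroup (16 + t) (13 + t) (9 + t) ⟩
  4 * ((16 + t) * (13 + t)) * ((16 + t) * (9 + t))    ∎
  where
  open ≤-Reasoning
  fourth-power : ∀ x → x * (x * (x * (x * 1))) ≡ x * x * (x * x)
  fourth-power = solve-∀
  regroup : ∀ x a b → x * x * (4 * (a * b)) ≡ 4 * (x * a) * (x * b)
  regroup = solve-∀
  expand : ∀ t → (16 + t) * (16 + t) + (212 + 56 * t + 3 * (t * t)) ≡ 4 * ((13 + t) * (9 + t))
  expand = solve-∀
  square≤ : (16 + t) * (16 + t) ≤ 4 * ((13 + t) * (9 + t))
  square≤ = ≤-trans (m≤m+n ((16 + t) * (16 + t)) (212 + 56 * t + 3 * (t * t))) (≤-reflexive (expand t))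

-- 13 + t = n − 3 and 9 + t = n − 7 are the factors n + 1 − 4s of the recurrence for s = 1, 2.
quartic-bound : ∀ {n} t → 16 + t ≡ n → ∀ e₁ e₂ e₃ →
  e₁ * (n * (13 + t)) ≤ 2 * (e₂ * (1 * 2)) →
  e₂ * (n * (9 + t)) ≤ 2 * (e₃ * (2 * 3)) →
  e₁ * n ^ 4 ≤ 192 * e₃
quartic-bound t refl e₁ e₂ e₃ h₁ h₂ = begin
  e₁ * (16 + t) ^ 4                   ≤⟨ *-monoʳ-≤ e₁ (fourth-power≤ t) ⟩
  e₁ * (4 * A * B)                    ≡⟨ regroup₁ e₁ A B ⟩
  4 * (e₁ * A) * B                    ≤⟨ *-monoˡ-≤ B (*-monoʳ-≤ 4 h₁) ⟩
  4 * (2 * (e₂ * (1 * 2))) * B        ≡⟨ regroup₂ e₂ B ⟩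
  16 * (e₂ * B)                       ≤⟨ *-monoʳ-≤ 16 h₂ ⟩
  16 * (2 * (e₃ * (2 * 3)))           ≡⟨ regroup₃ e₃ ⟩
  192 * e₃                            ∎
  where
  open ≤-Reasoning
  A B : ℕ
  A = (16 + t) * (13 + t)
  B = (16 + t) * (9 + t)
  regroup₁ : ∀ e a b → e * (4 * a * b) ≡ 4 * (e * a) * b
  regroup₁ = solve-∀
  regroup₂ : ∀ e b → 4 * (2 * (e * (1 * 2))) * b ≡ 16 * (e * b)
  regroup₂ = solve-∀
  regroup₃ : ∀ e → 16 * (2 * (e * (2 * 3))) ≡ 192 * e
  regroup₃ = solve-∀

square-split₁ : ∀ m → (3 + m) * m + 4 * (1 * (3 + m)) ≡ (3 + m) * (3 + m) + (3 + m)
square-split₁ = solve-∀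

square-split₂ : ∀ m → (7 + m) * m + 4 * (2 * (7 + m)) ≡ (7 + m) * (7 + m) + (7 + m)
square-split₂ = solve-∀

lemmaB1 : (n : ℕ) → 16 ≤ n → (v w : Fin (suc (2 * n))) →
    length (𝓔vw n v w) * n ^ 4 ≤ 2 ^ 14 * length (𝓔 n)
lemmaB1 n 16≤n v w = begin
  length (𝓔vw n v w) * n ^ 4   ≡⟨ cong (_* n ^ 4) (length-𝓔vw (≤-trans (s≤s z≤n) 16≤n)) ⟩
  levelSize 1 * n ^ 4           ≤⟨ quartic-bound t 16+t≡n (levelSize 1) (levelSize 2) (levelSize 3)
                                     (levelSize-recurrence 1 (n * (13 + t)) split₁)
                                     (levelSize-recurrence 2 (n * (9 + t)) split₂) ⟩
  192 * levelSize 3             ≤⟨ *-mono-≤ (m≤m+n 192 16192) (levelSize≤length-𝓔 3) ⟩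
  2 ^ 14 * length (𝓔 n)        ∎
  where
  open ≤-Reasoning
  open Levels n v w using (levelSize; levelSize-recurrence; levelSize≤length-𝓔; length-𝓔vw)
  -- Keep n abstract: after matching on 16 + t ≡ n, Agda unfolds allDigraphs (33 + 2t) and runs out of memory.
  t : ℕ
  t = proj₁ (m≤n⇒∃[o]m+o≡n 16≤n)
  16+t≡n : 16 + t ≡ n
  16+t≡n = proj₂ (m≤n⇒∃[o]m+o≡n 16≤n)
  split₁ : n * (13 + t) + 4 * (1 * n) ≡ n * n + n
  split₁ = subst (λ n → n * (13 + t) + 4 * (1 * n) ≡ n * n + n) 16+t≡n (square-split₁ (13 + t))
  split₂ : n * (9 + t) + 4 * (2 * n) ≡ n * n + n
  split₂ = subst (λ n → n * (9 + t) + 4 * (2 * n) ≡ n * n + n) 16+t≡n (square-split₂ (9 + t))
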